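{- Let $x[1..n]$ be a framed word as described in the context. For every $i\in[1,n]$, \[ \lambda^{ -1}[i]=\mathit{next}_{ -1}[i]-i+\mathrm{lce}(i,\mathit{next}_{ -1}[i]). \]
   Context: Let $(\Sigma,<)$ be a totally ordered alphabet. The lexicographic order $\prec$ on words is: $u\prec v$ iff either $v=uw$ for some non-empty word $w$, or $u=ary$, $v=asy'$ for words $a,y,y'$ and letters $r<s$. A framed word is a word $x[1..n]$ ($n\ge 2$) with $x[1]=\#$, $x[n]=\$$ and $x[2..n-1]\in\Sigma^*$, where the order on $\Sigma$ is extended by $\# > \$ > a$ for all $a\in\Sigma$. For $1\le i\le n$, $x_i=x[i..n]$, and $x_{n+1}$ is the empty word. $\mathrm{lce}(i,j)$ is the length of the longest common prefix of $x_i$ and $x_j$. A non-empty word $w$ is an inverse Lyndon word if $s\prec w$ for every non-empty proper suffix $s$ of $w$. The inverse Lyndon array is $\lambda^{ -1}[i]=\max\{m\in[1,n-i+1]\mid x[i..i+m-1]\text{ is an inverse Lyndon word}\}$. The next greater suffix array is $\mathit{next}_{ -1}[i]=\min\{j\in(i,n]\mid x_j\succ x_i\}$, with the conventions $\mathit{next}_{ -1}[1]=\mathit{next}_{ -1}[n]=n+1$. -}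

module Defs where

open import Level using (Level; _⊔_)
open import Data.Nat using (ℕ; zero; suc; _+_; _∸_; _≤_; _<_)
open import Data.List using (List; []; _∷_; _++_; [_]; map; length; take; drop)
open import Data.Product using (Σ; ∃; _×_; _,_)
open import Data.Sum using (_⊎_)
open import Relation.Nullary using (¬_; yes; no)
open import Relation.Binary.Core using (Rel)
open import Relation.Binary.Structures using (IsStrictTotalOrder)
open import Relation.Binary.PropositionalEquality using (_≡_; _≢_; cong)

module Framed {a ℓ : Level} {A : Set a} {_<ₐ_ : Rel A ℓ}
              (sto : IsStrictTotalOrder _≡_ _<ₐ_) where

  data Letter : Set a where
    ♯   : Letter
    ＄  : Letter
    chr : A → Letter

  data _<ᴸ_ : Letter → Letter → Set (a ⊔ ℓ) where
    chr<chr : ∀ {r s} → r <ₐ s → chr r <ᴸ chr s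
    chr<＄  : ∀ {r} → chr r <ᴸ ＄
    chr<♯   : ∀ {r} → chr r <ᴸ ♯
    ＄<♯    : ＄ <ᴸ ♯

  Word : Set a
  Word = List Letter

  _≺_ : Word → Word → Set (a ⊔ ℓ)
  u ≺ v =
    (Σ Letter λ c → Σ Word λ w → v ≡ u ++ (c ∷ w))
    ⊎ (Σ Word λ p → Σ Letter λ r → Σ Letter λ s → Σ Word λ y → Σ Word λ y' →
         (r <ᴸ s) × (u ≡ p ++ (r ∷ y)) × (v ≡ p ++ (s ∷ y')))

  -- the framed word #w$ whose interior is w ∈ Σ*
  -- (every framed word is of this form, for a unique w)
  frame : List A → Word
  frame w = ♯ ∷ (map chr w ++ [ ＄ ])

  InvLyndon : Word → Set (a ⊔ ℓ)
  InvLyndon w = (1 ≤ length w) × (∀ k → 1 ≤ k → k < length w → drop k w ≺ w)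

  -- 1-based suffix x_i = x[i..n];  x_{n+1} is the empty word
  suf : Word → ℕ → Word
  suf x i = drop (i ∸ 1) x

  factor : Word → ℕ → ℕ → Word
  factor x i m = take m (suf x i)

  IsInvLyndonArr : Word → ℕ → ℕ → Set (a ⊔ ℓ)
  IsInvLyndonArr x i m =
    (1 ≤ m) × (m ≤ suc (length x) ∸ i) × InvLyndon (factor x i m) ×
    (∀ m' → 1 ≤ m' → m' ≤ suc (length x) ∸ i → InvLyndon (factor x i m') → m' ≤ m)

  IsNextGreater : Word → ℕ → ℕ → Set (a ⊔ ℓ)
  IsNextGreater x i j =
    ((i ≡ 1 ⊎ i ≡ length x) × j ≡ suc (length x))
    ⊎ ((i ≢ 1) × (i ≢ length x) × (i < j) × (j ≤ length x) ×
       (suf x i ≺ suf x j) ×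
       (∀ k → i < k → k < j → ¬ (suf x i ≺ suf x k)))

  open IsStrictTotalOrder sto using (_≟_)

  _≟ᴸ_ : (p q : Letter) → Relation.Nullary.Dec (p ≡ q)
  ♯ ≟ᴸ ♯ = yes _≡_.refl
  ♯ ≟ᴸ ＄ = no λ ()
  ♯ ≟ᴸ chr _ = no λ ()
  ＄ ≟ᴸ ♯ = no λ ()
  ＄ ≟ᴸ ＄ = yes _≡_.refl
  ＄ ≟ᴸ chr _ = no λ ()
  chr _ ≟ᴸ ♯ = no λ ()
  chr _ ≟ᴸ ＄ = no λ ()
  chr r ≟ᴸ chr s with r ≟ s
  ... | yes _≡_.refl = yes _≡_.refl
  ... | no r≢s = no λ { _≡_.refl → r≢s _≡_.refl }

  lcp : Word → Word → ℕ
  lcp [] _ = 0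
  lcp (_ ∷ _) [] = 0
  lcp (p ∷ u) (q ∷ v) with p ≟ᴸ q
  ... | yes _ = suc (lcp u v)
  ... | no _ = 0

  lce : Word → ℕ → ℕ → ℕ
  lce x i j = lcp (suf x i) (suf x j)

-- Let u = x_i and let d be the offset of the first suffix of u greater than u
-- (d = |u| if there is none), so that next₋₁[i] = i + d, and let l = lce(i, i+d).
-- Every suffix of u starting before d is smaller than u, and u[0 .. d + l) has
-- period d because u[d .. d + l) = u[0 .. l); hence every proper suffix of
-- p = u[0 .. d + l) reduces to one starting before d and is smaller than p.
-- No longer prefix works: it contains the letter at which u[d ..] overtakes u,
-- so its suffix at offset d is greater than the prefix itself.
module Submission where

open import Level using (Level; _⊔_)
open import Data.Nat using (ℕ; zero; suc; _+_; _∸_; _≤_; _<_; z≤n; s≤s; s≤s⁻¹; _<?_; _≟_)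
open import Data.Nat.Induction using (<-wellFounded)
open import Data.Nat.Properties
open import Data.List using (List; []; _∷_; _++_; [_]; map; length; take; drop)
open import Data.List.Properties using (length-drop; length-take; take-take; take-drop; drop-drop)
open import Data.List.Relation.Binary.Pointwise using (Pointwise-≡⇒≡; ≡⇒Pointwise-≡)
open import Data.List.Relation.Binary.Lex.Strict using (Lex-<; base; halt; this; next)
  renaming (<-isStrictTotalOrder to Lex-<-isStrictTotalOrder)
open import Data.Product using (Σ; ∃-syntax; _×_; _,_)
open import Data.Sum using (_⊎_; inj₁; inj₂)
open import Induction.WellFounded using (Acc; acc)
open import Relation.Nullary using (¬_; yes; no; contradiction)
open import Relation.Nullary.Decidable using (_⊎-dec_)
open import Relation.Unary using (Pred; Decidable)
open import Relation.Binary.Core using (Rel)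
open import Relation.Binary.Definitions using (Trichotomous; Tri; tri<; tri≈; tri>)
open import Relation.Binary.Structures using (IsStrictTotalOrder)
open import Relation.Binary.PropositionalEquality
  using (_≡_; _≢_; refl; sym; trans; cong; cong₂; subst; resp₂; isEquivalence; module ≡-Reasoning)
open import Defs

module _ {p} {P : Pred ℕ p} (P? : Decidable P) where

  Least : ℕ → Set p
  Least d = P d × (∀ {k} → k < d → ¬ P k)

  searchUpTo : ∀ n → (∃[ d ] d ≤ n × Least d) ⊎ (∀ {k} → k ≤ n → ¬ P k)
  searchUpTo zero with P? zero
  ... | yes p0 = inj₁ (zero , z≤n , p0 , λ ())
  ... | no ¬p0 = inj₂ λ { z≤n → ¬p0 }
  searchUpTo (suc n) with searchUpTo n
  ... | inj₁ (d , d≤n , least) = inj₁ (d , m≤n⇒m≤1+n d≤n , least)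
  ... | inj₂ none with P? (suc n)
  ...   | yes pn = inj₁ (suc n , ≤-refl , pn , λ k<1+n → none (s≤s⁻¹ k<1+n))
  ...   | no ¬pn = inj₂ λ k≤1+n → case (m≤n⇒m<n∨m≡n k≤1+n)
    where
    case : ∀ {k} → k < suc n ⊎ k ≡ suc n → ¬ P k
    case (inj₁ k<1+n) = none (s≤s⁻¹ k<1+n)
    case (inj₂ refl) = ¬pn

  leastWitness : ∀ {n} → P n → ∃[ d ] d ≤ n × Least d
  leastWitness {n} pn with searchUpTo n
  ... | inj₁ found = found
  ... | inj₂ none = contradiction pn (none ≤-refl)

module _ {a} {X : Set a} where

  length-take-≤ : ∀ {n} (u : List X) → n ≤ length u → length (take n u) ≡ n
  length-take-≤ {n} u n≤|u| = trans (length-take n u) (m≤n⇒m⊓n≡m n≤|u|)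

  drop-≢ : ∀ {k} (u : List X) → 0 < k → k ≤ length u → drop k u ≢ u
  drop-≢ {k} u 0<k k≤|u| eq = <-irrefl (cong length eq)
    (subst (_< length u) (sym (length-drop k u)) (∸-monoʳ-< 0<k k≤|u|))

  drop-nonempty : ∀ {i} (u : List X) → i < length u → 1 ≤ length (drop i u)
  drop-nonempty {i} u i<|u| = subst (1 ≤_) (sym (length-drop i u)) (m<n⇒0<n∸m i<|u|)

  drop-take : ∀ {k n} (u : List X) → k ≤ n → drop k (take n u) ≡ take (n ∸ k) (drop k u)
  drop-take {k} {n} u k≤n = begin
    drop k (take n u)              ≡⟨ cong (λ m → drop k (take m u)) (sym (m+[n∸m]≡n k≤n)) ⟩
    drop k (take (k + (n ∸ k)) u)  ≡⟨ sym (take-drop (n ∸ k) k u) ⟩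
    take (n ∸ k) (drop k u)        ∎
    where open ≡-Reasoning

  take-drop-cong : ∀ {n} k a (u v : List X) → k + a ≤ n → take n u ≡ take n v →
                   take a (drop k u) ≡ take a (drop k v)
  take-drop-cong {n} k a u v k+a≤n prefix≡ = begin
    take a (drop k u)                   ≡⟨ take-drop a k u ⟩
    drop k (take (k + a) u)             ≡⟨ cong (drop k) (shorter u) ⟩
    drop k (take (k + a) (take n u))    ≡⟨ cong (λ w → drop k (take (k + a) w)) prefix≡ ⟩
    drop k (take (k + a) (take n v))    ≡⟨ cong (drop k) (sym (shorter v)) ⟩
    drop k (take (k + a) v)             ≡⟨ sym (take-drop a k v) ⟩
    take a (drop k v)                   ∎
    where
    open ≡-Reasoning
    shorter : ∀ w → take (k + a) w ≡ take (k + a) (take n w)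
    shorter w = sym (trans (take-take (k + a) n w) (cong (λ m → take m w) (m≤n⇒m⊓n≡m k+a≤n)))

module _ {a ℓ : Level} {A : Set a} {_<ₐ_ : Rel A ℓ} (sto : IsStrictTotalOrder _≡_ _<ₐ_) where
  open Framed sto
  private module Alphabet = IsStrictTotalOrder sto

  <ᴸ-irrefl : ∀ {p} → ¬ p <ᴸ p
  <ᴸ-irrefl (chr<chr r<r) = Alphabet.irrefl refl r<r

  <ᴸ-trans : ∀ {p q r} → p <ᴸ q → q <ᴸ r → p <ᴸ r
  <ᴸ-trans (chr<chr p<q) (chr<chr q<r) = chr<chr (Alphabet.trans p<q q<r)
  <ᴸ-trans (chr<chr _) chr<＄ = chr<＄
  <ᴸ-trans (chr<chr _) chr<♯ = chr<♯
  <ᴸ-trans chr<＄ ＄<♯ = chr<♯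

  below : ∀ {p q} → p <ᴸ q → Tri (p <ᴸ q) (p ≡ q) (q <ᴸ p)
  below p<q = tri< p<q (λ { refl → <ᴸ-irrefl p<q }) (λ q<p → <ᴸ-irrefl (<ᴸ-trans p<q q<p))

  above : ∀ {p q} → q <ᴸ p → Tri (p <ᴸ q) (p ≡ q) (q <ᴸ p)
  above q<p = tri> (λ p<q → <ᴸ-irrefl (<ᴸ-trans p<q q<p)) (λ { refl → <ᴸ-irrefl q<p }) q<p

  <ᴸ-compare : Trichotomous _≡_ _<ᴸ_
  <ᴸ-compare ♯ ♯ = tri≈ <ᴸ-irrefl refl <ᴸ-irrefl
  <ᴸ-compare ♯ ＄ = above ＄<♯
  <ᴸ-compare ♯ (chr _) = above chr<♯
  <ᴸ-compare ＄ ♯ = below ＄<♯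
  <ᴸ-compare ＄ ＄ = tri≈ <ᴸ-irrefl refl <ᴸ-irrefl
  <ᴸ-compare ＄ (chr _) = above chr<＄
  <ᴸ-compare (chr _) ♯ = below chr<♯
  <ᴸ-compare (chr _) ＄ = below chr<＄
  <ᴸ-compare (chr r) (chr s) with Alphabet.compare r s
  ... | tri< r<s _ _ = below (chr<chr r<s)
  ... | tri≈ _ refl _ = tri≈ <ᴸ-irrefl refl <ᴸ-irrefl
  ... | tri> _ _ s<r  = above (chr<chr s<r)

  <ᴸ-isStrictTotalOrder : IsStrictTotalOrder _≡_ _<ᴸ_
  <ᴸ-isStrictTotalOrder = record
    { isStrictPartialOrder = record
      { isEquivalence = isEquivalence
      ; irrefl = λ { refl → <ᴸ-irrefl }
      ; trans = <ᴸ-trans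
      ; <-resp-≈ = resp₂ _<ᴸ_
      }
    ; compare = <ᴸ-compare
    }

  infix 4 _<ʷ_
  _<ʷ_ : Rel Word (a ⊔ ℓ)
  _<ʷ_ = Lex-< _≡_ _<ᴸ_

  private module Lex = IsStrictTotalOrder (Lex-<-isStrictTotalOrder <ᴸ-isStrictTotalOrder)

  <ʷ-irrefl : ∀ {u} → ¬ u <ʷ u
  <ʷ-irrefl = Lex.irrefl (≡⇒Pointwise-≡ refl)

  ++-<ʷ : ∀ u {c w} → u <ʷ u ++ (c ∷ w)
  ++-<ʷ [] = halt
  ++-<ʷ (_ ∷ u) = next refl (++-<ʷ u)

  mismatch-<ʷ : ∀ p {r s y y'} → r <ᴸ s → p ++ (r ∷ y) <ʷ p ++ (s ∷ y')
  mismatch-<ʷ [] r<s = this r<s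
  mismatch-<ʷ (_ ∷ p) r<s = next refl (mismatch-<ʷ p r<s)

  ≺⇒<ʷ : ∀ {u v} → u ≺ v → u <ʷ v
  ≺⇒<ʷ {u} (inj₁ (_ , _ , refl)) = ++-<ʷ u
  ≺⇒<ʷ (inj₂ (p , _ , _ , _ , _ , r<s , refl , refl)) = mismatch-<ʷ p r<s

  <ʷ⇒≺ : ∀ {u v} → u <ʷ v → u ≺ v
  <ʷ⇒≺ (base ())
  <ʷ⇒≺ (halt {c} {w}) = inj₁ (c , w , refl)
  <ʷ⇒≺ (this {r} {y} {s} {y'} r<s) = inj₂ ([] , r , s , y , y' , r<s , refl , refl)
  <ʷ⇒≺ (next {c} refl u<v) with <ʷ⇒≺ u<v
  ... | inj₁ (e , w , refl) = inj₁ (e , w , refl)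
  ... | inj₂ (p , r , s , y , y' , r<s , refl , refl) = inj₂ (c ∷ p , r , s , y , y' , r<s , refl , refl)

  take-<ʷ-take : ∀ {u v} → u <ʷ v → ∀ {a b} → a < b → take a u <ʷ take b v
  take-<ʷ-take (base ())
  take-<ʷ-take halt {zero} {suc _} _ = halt
  take-<ʷ-take halt {suc _} {suc _} _ = halt
  take-<ʷ-take (this _) {zero} {suc _} _ = halt
  take-<ʷ-take (this r<s) {suc _} {suc _} _ = this r<s
  take-<ʷ-take (next refl _) {zero} {suc _} _ = halt
  take-<ʷ-take (next refl u<v) {suc _} {suc _} (s≤s a<b) = next refl (take-<ʷ-take u<v a<b)

  take-<ʷ-take-self : ∀ u {a b} → a < b → b ≤ length u → take a u <ʷ take b u
  take-<ʷ-take-self (_ ∷ _) {zero} {suc _} _ _ = halt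
  take-<ʷ-take-self (_ ∷ u) {suc _} {suc _} (s≤s a<b) (s≤s b≤|u|) = next refl (take-<ʷ-take-self u a<b b≤|u|)

  take-lcp : ∀ u v → take (lcp u v) u ≡ take (lcp u v) v
  take-lcp [] _ = refl
  take-lcp (_ ∷ _) [] = refl
  take-lcp (p ∷ u) (q ∷ v) with p ≟ᴸ q
  ... | yes refl = cong (p ∷_) (take-lcp u v)
  ... | no _ = refl

  lcp≤length : ∀ u v → lcp u v ≤ length v
  lcp≤length [] _ = z≤n
  lcp≤length (_ ∷ _) [] = z≤n
  lcp≤length (p ∷ u) (q ∷ v) with p ≟ᴸ q
  ... | yes refl = s≤s (lcp≤length u v)
  ... | no _ = z≤n

  -- When v is no longer than u, u <ʷ v is witnessed by a mismatch at position lcp u v.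
  take-<ʷ-take-past-lcp : ∀ {u v} → u <ʷ v → length v ≤ length u → ∀ {a b} →
                          lcp u v < a → lcp u v < b → take a u <ʷ take b v
  take-<ʷ-take-past-lcp (base ())
  take-<ʷ-take-past-lcp halt ()
  take-<ʷ-take-past-lcp (this {r} {_} {s} r<s) _ _ _ with r ≟ᴸ s
  take-<ʷ-take-past-lcp (this r<s) _ _ _ | yes refl = contradiction r<s <ᴸ-irrefl
  take-<ʷ-take-past-lcp (this r<s) _ {suc _} {suc _} _ _ | no _ = this r<s
  take-<ʷ-take-past-lcp (next {c} refl u<v) _ _ _ with c ≟ᴸ c
  take-<ʷ-take-past-lcp (next refl u<v) (s≤s |v|≤|u|) {suc _} {suc _} (s≤s l<a) (s≤s l<b) | yes _ =
    next refl (take-<ʷ-take-past-lcp u<v |v|≤|u| l<a l<b)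
  ... | no c≢c = contradiction refl c≢c

  IsLongestInvLyndonPrefix : Word → ℕ → Set (a ⊔ ℓ)
  IsLongestInvLyndonPrefix u m = (1 ≤ m) × (m ≤ length u) × InvLyndon (take m u) ×
    (∀ m' → 1 ≤ m' → m' ≤ length u → InvLyndon (take m' u) → m' ≤ m)

  record FirstGreaterSuffix (u : Word) (d : ℕ) : Set (a ⊔ ℓ) where
    field
      positive : 1 ≤ d
      bounded : d ≤ length u
      earlier-smaller : ∀ {k} → 1 ≤ k → k < d → drop k u <ʷ u
      greater-suffix : d < length u → u <ʷ drop d u

  GreaterSuffixOrEnd : Word → ℕ → Set (a ⊔ ℓ)
  GreaterSuffixOrEnd u k = u <ʷ drop k u ⊎ k ≡ length u

  greaterSuffixOrEnd? : ∀ u → Decidable (GreaterSuffixOrEnd u)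
  greaterSuffixOrEnd? u k = Lex._<?_ u (drop k u) ⊎-dec (k ≟ length u)

  firstGreaterSuffix : ∀ u → 1 ≤ length u → ∃[ d ] FirstGreaterSuffix u d
  firstGreaterSuffix u 1≤|u| with leastWitness (greaterSuffixOrEnd? u) {length u} (inj₂ refl)
  ... | d , d≤|u| , Pd , before-d = d , record
    { positive = n≢0⇒n>0 λ { refl → ¬P0 Pd }
    ; bounded = d≤|u|
    ; earlier-smaller = earlier-smaller
    ; greater-suffix = λ d<|u| → greater-suffix d<|u| Pd
    }
    where
    P : ℕ → Set (a ⊔ ℓ)
    P = GreaterSuffixOrEnd u

    ¬P0 : ¬ P 0
    ¬P0 (inj₁ u<u) = <ʷ-irrefl u<u
    ¬P0 (inj₂ 0≡|u|) = <-irrefl 0≡|u| 1≤|u|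

    earlier-smaller : ∀ {k} → 1 ≤ k → k < d → drop k u <ʷ u
    earlier-smaller {k} 1≤k k<d with Lex.compare (drop k u) u
    ... | tri< smaller _ _ = smaller
    ... | tri≈ _ same _ = contradiction (Pointwise-≡⇒≡ same) (drop-≢ u 1≤k (<⇒≤ (<-≤-trans k<d d≤|u|)))
    ... | tri> _ _ greater = contradiction (inj₁ greater) (before-d k<d)

    greater-suffix : d < length u → P d → u <ʷ drop d u
    greater-suffix _ (inj₁ greater) = greater
    greater-suffix d<|u| (inj₂ d≡|u|) = contradiction d≡|u| (<⇒≢ d<|u|)

  module _ {u d} (first : FirstGreaterSuffix u d) where
    open FirstGreaterSuffix first

    private
      l = lcp u (drop d u)
      m = d + l

    d+lcp≤length : m ≤ length u
    d+lcp≤length = begin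
      d + l                   ≤⟨ +-monoʳ-≤ d (lcp≤length u (drop d u)) ⟩
      d + length (drop d u)   ≡⟨ cong (d +_) (length-drop d u) ⟩
      d + (length u ∸ d)      ≡⟨ m+[n∸m]≡n bounded ⟩
      length u                ∎
      where open ≤-Reasoning

    period : ∀ {k a} → d ≤ k → k + a ≤ m → take a (drop k u) ≡ take a (drop (k ∸ d) u)
    period {k} {a} d≤k k+a≤m = begin
      take a (drop k u)                   ≡⟨ cong (λ j → take a (drop j u)) (sym (m+[n∸m]≡n d≤k)) ⟩
      take a (drop (d + (k ∸ d)) u)       ≡⟨ cong (take a) (sym (drop-drop d (k ∸ d) u)) ⟩
      take a (drop (k ∸ d) (drop d u))    ≡⟨ sym (take-drop-cong (k ∸ d) a u (drop d u) k∸d+a≤l (take-lcp u (drop d u))) ⟩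
      take a (drop (k ∸ d) u)             ∎
      where
      open ≡-Reasoning
      k∸d+a≤l : k ∸ d + a ≤ l
      k∸d+a≤l = +-cancelˡ-≤ d _ _ (subst (_≤ m)
        (trans (cong (_+ a) (sym (m+[n∸m]≡n d≤k))) (+-assoc d (k ∸ d) a)) k+a≤m)

    factor-<ʷ-prefix : ∀ k → Acc _<_ k → ∀ {a} → k + a ≤ m → a < m → take a (drop k u) <ʷ take m u
    factor-<ʷ-prefix zero _ _ a<m = take-<ʷ-take-self u a<m d+lcp≤length
    factor-<ʷ-prefix k@(suc _) (acc smaller) {a} k+a≤m a<m with k <? d
    ... | yes k<d = take-<ʷ-take (earlier-smaller (s≤s z≤n) k<d) a<m
    ... | no k≮d = subst (_<ʷ take m u) (sym (period d≤k k+a≤m))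
          (factor-<ʷ-prefix (k ∸ d) (smaller (∸-monoʳ-< positive d≤k))
            (≤-trans (+-monoˡ-≤ a (m∸n≤m k d)) k+a≤m) a<m)
      where
      d≤k : d ≤ k
      d≤k = ≮⇒≥ k≮d

    prefix-invLyndon : InvLyndon (take m u)
    prefix-invLyndon = subst (1 ≤_) (sym |p|≡m) (≤-trans positive (m≤m+n d l)) , suffix-smaller
      where
      |p|≡m : length (take m u) ≡ m
      |p|≡m = length-take-≤ u d+lcp≤length

      suffix-smaller : ∀ k → 1 ≤ k → k < length (take m u) → drop k (take m u) ≺ take m u
      suffix-smaller k 1≤k k<|p| = <ʷ⇒≺ (subst (_<ʷ take m u) (sym (drop-take u (<⇒≤ k<m)))
        (factor-<ʷ-prefix k (<-wellFounded k) (≤-reflexive (m+[n∸m]≡n (<⇒≤ k<m)))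
          (∸-monoʳ-< 1≤k (<⇒≤ k<m))))
        where
        k<m : k < m
        k<m = subst (k <_) |p|≡m k<|p|

    longer-prefix-not-invLyndon : ∀ {m'} → m < m' → m' ≤ length u → ¬ InvLyndon (take m' u)
    longer-prefix-not-invLyndon {m'} m<m' m'≤|u| (_ , suffix-smaller) =
      Lex.asym prefix<suffix (≺⇒<ʷ (suffix-smaller d positive d<|p|))
      where
      d<m' : d < m'
      d<m' = ≤-<-trans (m≤m+n d l) m<m'

      d<|p| : d < length (take m' u)
      d<|p| = subst (d <_) (sym (length-take-≤ u m'≤|u|)) d<m'

      l<m'∸d : l < m' ∸ d
      l<m'∸d = +-cancelˡ-< d l (m' ∸ d) (subst (m <_) (sym (m+[n∸m]≡n (<⇒≤ d<m'))) m<m')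

      prefix<suffix : take m' u <ʷ drop d (take m' u)
      prefix<suffix = subst (take m' u <ʷ_) (sym (drop-take u (<⇒≤ d<m')))
        (take-<ʷ-take-past-lcp (greater-suffix (<-≤-trans d<m' m'≤|u|))
          (subst (_≤ length u) (sym (length-drop d u)) (m∸n≤m (length u) d))
          (≤-<-trans (m≤n+m l d) m<m') l<m'∸d)

    longestInvLyndonPrefix : IsLongestInvLyndonPrefix u m
    longestInvLyndonPrefix = ≤-trans positive (m≤m+n d l) , d+lcp≤length , prefix-invLyndon ,
      λ m' _ m'≤|u| inv → ≮⇒≥ λ m<m' → longer-prefix-not-invLyndon m<m' m'≤|u| inv

  longest⇒IsInvLyndonArr : ∀ x i0 {m} → IsLongestInvLyndonPrefix (drop i0 x) m → IsInvLyndonArr x (suc i0) m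
  longest⇒IsInvLyndonArr x i0 (1≤m , m≤|u| , inv , maximal) =
    1≤m , subst (_ ≤_) (length-drop i0 x) m≤|u| , inv ,
    λ m' 1≤m' m'≤ → maximal m' 1≤m' (subst (m' ≤_) (sym (length-drop i0 x)) m'≤)

  nextGreater-offset : ∀ x i0 {d} → FirstGreaterSuffix (drop i0 x) d → d < length (drop i0 x) →
    (suc i0 < suc i0 + d) × (suc i0 + d ≤ length x) × (suf x (suc i0) ≺ suf x (suc i0 + d)) ×
    (∀ k → suc i0 < k → k < suc i0 + d → ¬ (suf x (suc i0) ≺ suf x k))
  nextGreater-offset x i0 {d} first d<|u| =
    s≤s (m<m+n i0 positive) , i0+d<|x| ,
    <ʷ⇒≺ (subst (drop i0 x <ʷ_) (drop-drop i0 d x) (greater-suffix d<|u|)) ,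
    minimal
    where
    open FirstGreaterSuffix first

    i0+d<|x| : i0 + d < length x
    i0+d<|x| = subst (i0 + d <_) (m+[n∸m]≡n i0≤|x|) (+-monoʳ-< i0 (subst (d <_) (length-drop i0 x) d<|u|))
      where
      i0≤|x| : i0 ≤ length x
      i0≤|x| = ≮⇒≥ λ |x|<i0 → contradiction (subst (d <_) (trans (length-drop i0 x) (m≤n⇒m∸n≡0 (<⇒≤ |x|<i0))) d<|u|) λ ()

    minimal : ∀ k → suc i0 < k → k < suc i0 + d → ¬ (drop i0 x ≺ suf x k)
    minimal (suc k) (s≤s i0<k) (s≤s k<i0+d) u≺x_k =
      Lex.asym (earlier-smaller (m<n⇒0<n∸m i0<k) e<d) (subst (drop i0 x <ʷ_) x_k≡u_e (≺⇒<ʷ u≺x_k))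
      where
      i0+e≡k : i0 + (k ∸ i0) ≡ k
      i0+e≡k = m+[n∸m]≡n (<⇒≤ i0<k)

      e<d : k ∸ i0 < d
      e<d = +-cancelˡ-< i0 _ _ (subst (_< i0 + d) (sym i0+e≡k) k<i0+d)

      x_k≡u_e : drop k x ≡ drop (k ∸ i0) (drop i0 x)
      x_k≡u_e = trans (cong (λ j → drop j x) (sym i0+e≡k)) (sym (drop-drop i0 (k ∸ i0) x))

  terminated : List A → Word
  terminated t = map chr t ++ [ ＄ ]

  length-terminated : ∀ t → length (terminated t) ≡ suc (length t)
  length-terminated [] = refl
  length-terminated (_ ∷ t) = cong suc (length-terminated t)

  drop-terminated : ∀ t {i} → i ≤ length t → drop i (terminated t) ≡ terminated (drop i t)
  drop-terminated t {zero} _ = refl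
  drop-terminated (_ ∷ t) {suc i} (s≤s i≤|t|) = drop-terminated t i≤|t|

  drop-length-terminated : ∀ t → drop (length t) (terminated t) ≡ [ ＄ ]
  drop-length-terminated [] = refl
  drop-length-terminated (_ ∷ t) = drop-length-terminated t

  terminated-<ʷ-＄ : ∀ {t} → 1 ≤ length t → terminated t <ʷ [ ＄ ]
  terminated-<ʷ-＄ {_ ∷ _} _ = this chr<＄

  drop-terminated-<ʷ-♯ : ∀ t {k} → k < length (terminated t) → ∀ {v} → drop k (terminated t) <ʷ ♯ ∷ v
  drop-terminated-<ʷ-♯ [] {zero} _ = this ＄<♯
  drop-terminated-<ʷ-♯ (_ ∷ _) {zero} _ = this chr<♯
  drop-terminated-<ʷ-♯ (_ ∷ t) {suc k} (s≤s k<|v|) = drop-terminated-<ʷ-♯ t k<|v|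
  drop-terminated-<ʷ-♯ [] {suc _} (s≤s ())

  drop-frame-<ʷ : ∀ w {k} → 1 ≤ k → k < length (frame w) → drop k (frame w) <ʷ frame w
  drop-frame-<ʷ w {suc _} _ (s≤s k<|v|) = drop-terminated-<ʷ-♯ w k<|v|

  firstGreaterSuffix-terminated : ∀ {t d} → 1 ≤ length t → FirstGreaterSuffix (terminated t) d →
                                  d < length (terminated t)
  firstGreaterSuffix-terminated {t} {d} 1≤|t| first = ≤∧≢⇒< bounded λ d≡|v| →
    Lex.asym (terminated-<ʷ-＄ 1≤|t|)
      (subst (_<ʷ terminated t) (drop-length-terminated t) (earlier-smaller 1≤|t| (|t|<d d≡|v|)))
    where
    open FirstGreaterSuffix first
    |t|<d : d ≡ length (terminated t) → length t < d
    |t|<d d≡|v| = ≤-reflexive (sym (trans d≡|v| (length-terminated t)))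

  frame-nextGreater : ∀ w i0 {d} → suc i0 ≤ length (frame w) → FirstGreaterSuffix (drop i0 (frame w)) d →
                      IsNextGreater (frame w) (suc i0) (suc i0 + d)
  frame-nextGreater w zero {d} _ first = inj₁ (inj₁ refl , cong suc d≡|x|)
    where
    open FirstGreaterSuffix first
    d≡|x| : d ≡ length (frame w)
    d≡|x| = ≤-antisym bounded (≮⇒≥ λ d<|x| →
      Lex.asym (greater-suffix d<|x|) (drop-frame-<ʷ w positive d<|x|))
  frame-nextGreater w (suc i1) {d} i≤|x| first
    with m≤n⇒m<n∨m≡n (s≤s⁻¹ (subst (suc i1 ≤_) (length-terminated w) (s≤s⁻¹ i≤|x|)))
  ... | inj₂ refl = inj₁ (inj₂ (cong suc (sym (length-terminated w))) , j≡n+1)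
    where
    open FirstGreaterSuffix first
    d≡1 : d ≡ 1
    d≡1 = ≤-antisym (subst (d ≤_) (cong length (drop-length-terminated w)) bounded) positive
    j≡n+1 : suc (suc (length w)) + d ≡ suc (length (frame w))
    j≡n+1 = begin
      suc (suc (length w)) + d         ≡⟨ cong (suc (suc (length w)) +_) d≡1 ⟩
      suc (suc (length w)) + 1         ≡⟨ +-comm (suc (suc (length w))) 1 ⟩
      suc (suc (suc (length w)))       ≡⟨ cong (λ n → suc (suc n)) (sym (length-terminated w)) ⟩
      suc (length (frame w))           ∎
      where open ≡-Reasoning
  ... | inj₁ i1<|w| = inj₂ ((λ ()) , i≢|x| , nextGreater-offset (frame w) (suc i1) first d<|u|)
    where
    i≢|x| : suc (suc i1) ≢ length (frame w)
    i≢|x| eq = <-irrefl (suc-injective (trans (suc-injective eq) (length-terminated w))) i1<|w|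
    u≡ : drop (suc i1) (frame w) ≡ terminated (drop i1 w)
    u≡ = drop-terminated w (<⇒≤ i1<|w|)
    d<|u| : d < length (drop (suc i1) (frame w))
    d<|u| = subst (λ u → d < length u) (sym u≡)
      (firstGreaterSuffix-terminated (drop-nonempty w i1<|w|) (subst (λ u → FirstGreaterSuffix u d) u≡ first))

corollary1 : ∀ {a ℓ : Level} {A : Set a} {_<ₐ_ : Rel A ℓ} (sto : IsStrictTotalOrder _≡_ _<ₐ_) →
    let open Framed sto in
    (w : List A) → let x = frame w in
    (i : ℕ) → 1 ≤ i → i ≤ length x →
    Σ ℕ λ j → Σ ℕ λ m →
    IsNextGreater x i j × IsInvLyndonArr x i m × (m ≡ j ∸ i + lce x i j)
corollary1 sto w (suc i0) (s≤s z≤n) i≤|x|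
  with firstGreaterSuffix sto (drop i0 (Framed.frame sto w)) (drop-nonempty (Framed.frame sto w) i≤|x|)
... | d , first =
  suc i0 + d , d + lcp u (drop d u) ,
  frame-nextGreater sto w i0 i≤|x| first ,
  longest⇒IsInvLyndonArr sto x i0 (longestInvLyndonPrefix sto first) ,
  cong₂ _+_ (sym (m+n∸m≡n i0 d)) (cong (lcp u) (drop-drop i0 d x))
  where
  open Framed sto
  x = frame w
  u = drop i0 x
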